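{- Let $k\ge1$ and $m\ge0$ be integers. Then the Narayana number $N_{k,m}$ equals the number of cyclic compositions of $2k+1$ into $k$ parts such that exactly $m$ parts are at least $2$.
   Context: A composition of $n$ into $k$ parts is a sequence of $k$ positive integers summing to $n$; a cyclic composition is an equivalence class of compositions under cyclic shift. The Narayana numbers are $N_{n,j}=\frac{1}{n}\binom{n}{j}\binom{n}{j-1}$ for $n\ge1$, $j\ge0$ (so $N_{n,j}=0$ unless $1\le j\le n$). -}

module Defs where

open import Data.Nat using (ℕ; zero; suc; _+_; _*_; _≤_; _≤?_; _/_)
open import Data.Nat.Combinatorics using (_C_)
open import Data.List using (List; []; _∷_; _++_; length; filter)
open import Data.Nat.ListAction using (sum)
open import Data.List.Relation.Unary.All using (All)
open import Data.List.Relation.Unary.Any using (Any)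
open import Data.List.Relation.Unary.AllPairs using (AllPairs)
open import Data.Product using (Σ; ∃; _×_)
open import Relation.Binary.PropositionalEquality using (_≡_)
open import Relation.Nullary using (¬_)


-- Narayana number N_{n,j} = (1/n) C(n,j) C(n,j-1); zero unless 1 ≤ j ≤ n.
-- (n = 0 is outside the paper's range; we set it to 0.)
narayana : ℕ → ℕ → ℕ
narayana zero    _       = 0
narayana (suc n) zero    = 0
narayana (suc n) (suc j) = ((suc n C suc j) * (suc n C j)) / suc n

IsComposition : ℕ → ℕ → List ℕ → Set
IsComposition n k c = All (1 ≤_) c × length c ≡ k × sum c ≡ n

partsAtLeast2 : List ℕ → ℕ
partsAtLeast2 c = length (filter (2 ≤?_) c)

rotate : List ℕ → List ℕ
rotate []       = []
rotate (x ∷ xs) = xs ++ (x ∷ [])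

rotateN : ℕ → List ℕ → List ℕ
rotateN zero    c = c
rotateN (suc i) c = rotateN i (rotate c)

CyclicEquiv : List ℕ → List ℕ → Set
CyclicEquiv c d = ∃ λ i → rotateN i c ≡ d

-- The set {x | P x} splits into exactly N equivalence classes of R:
-- there is a list of N representatives, each satisfying P, pairwise
-- inequivalent, such that every x satisfying P is equivalent to one of them.
NumClasses : {A : Set} → (A → Set) → (A → A → Set) → ℕ → Set
NumClasses {A} P R N =
  Σ (List A) λ reps →
    length reps ≡ N
    × All P reps
    × AllPairs (λ a b → ¬ R a b) reps
    × (∀ x → P x → Any (R x) reps)

-- Recursing on the first part and applying Pascal's rule, there are C(k,m) C(s-1,m-1)
-- compositions of k + s into k parts with m parts at least 2; for s = k + 1 this is k N_{k,m}.
-- By the cycle lemma, a composition c of 2k+1 into k parts has exactly one rotation that is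
-- dominating (every prefix of length t sums to more than 2t), and a dominating composition has
-- k distinct rotations. So the dominating compositions represent the cyclic classes, each class
-- has k elements, and there are N_{k,m} classes.
module Submission where

open import Defs
open import Data.Nat using (ℕ; zero; suc; _+_; _*_; _∸_; _⊓_; _≤_; _<_; _≤?_; _<?_; _%_; z≤n; z<s; s≤s; s≤s⁻¹)
open import Data.Nat.Properties
open import Data.Nat.DivMod using (_/_; m≡m%n+[m/n]*n; m%n<n; m*n/n≡m)
open import Data.Nat.Combinatorics using (_C_; nCk+nC[k+1]≡[n+1]C[k+1])
open import Data.Nat.Tactic.RingSolver using (solve-∀)
open import Data.Nat.ListAction using (sum)
open import Data.Nat.ListAction.Properties using (sum-++; sum-↭)
open import Data.List using (List; []; _∷_; _++_; length; filter; map; take; drop; upTo; cartesianProduct)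
open import Data.List.Properties
  using ( length-++; length-map; length-drop; length-upTo; take-[]; take-all; drop-all; take-take
        ; ++-assoc; ++-identityʳ; ∷-injectiveʳ)
open import Data.List.Relation.Unary.All as All using (All; []; _∷_)
open import Data.List.Relation.Unary.Any as Any using (Any; here; there)
open import Data.List.Relation.Unary.AllPairs using (AllPairs; []; _∷_)
import Data.List.Relation.Unary.AllPairs.Properties as AllPairs
open import Data.List.Relation.Unary.Unique.Propositional using (Unique)
import Data.List.Relation.Unary.Unique.Propositional.Properties as Unique
open import Data.List.Relation.Binary.Disjoint.Propositional using (Disjoint)
open import Data.List.Membership.Propositional using (_∈_)
open import Data.List.Membership.Propositional.Properties
  using ( ∈-map⁺; ∈-map⁻; ∈-++⁺ˡ; ∈-++⁺ʳ; ∈-++⁻; ∈-filter⁺; ∈-filter⁻; ∈-upTo⁺; ∈-upTo⁻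
        ; ∈-cartesianProduct⁺; ∈-cartesianProduct⁻)
open import Data.List.Membership.Propositional.Properties.WithK using (unique∧set⇒bag)
open import Data.List.Relation.Binary.BagAndSetEquality using (∼bag⇒↭)
open import Data.List.Relation.Binary.Permutation.Propositional using (_↭_; ↭-refl; ↭-sym; ↭-trans)
open import Data.List.Relation.Binary.Permutation.Propositional.Properties
  using (↭-length; ∷↭∷ʳ; All-resp-↭; filter-↭)
open import Data.Product using (∃; ∃₂; _×_; _,_; proj₁; proj₂)
import Data.Product as Product
open import Data.Sum using (inj₁; inj₂; [_,_]′)
open import Data.Empty using (⊥-elim)
open import Function.Bundles using (_⇔_; mk⇔; Equivalence)
open import Relation.Binary.PropositionalEquality
open import Relation.Nullary using (Dec; yes; no; ¬_)

module _ {A : Set} where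

  take-+ : ∀ m n (xs : List A) → take (m + n) xs ≡ take m xs ++ take n (drop m xs)
  take-+ zero    n xs       = refl
  take-+ (suc m) n []       = sym (take-[] n)
  take-+ (suc m) n (x ∷ xs) = cong (x ∷_) (take-+ m n xs)

  take-++-length : ∀ n (xs ys : List A) → take (length xs + n) (xs ++ ys) ≡ xs ++ take n ys
  take-++-length n []       ys = refl
  take-++-length n (x ∷ xs) ys = cong (x ∷_) (take-++-length n xs ys)

  take-++ˡ : ∀ n (xs ys : List A) → n ≤ length xs → take n (xs ++ ys) ≡ take n xs
  take-++ˡ zero    xs       ys _       = refl
  take-++ˡ (suc n) (x ∷ xs) ys (s≤s p) = cong (x ∷_) (take-++ˡ n xs ys p)

  drop-++ˡ : ∀ n (xs ys : List A) → n ≤ length xs → drop n (xs ++ ys) ≡ drop n xs ++ ys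
  drop-++ˡ zero    xs       ys _       = refl
  drop-++ˡ (suc n) (x ∷ xs) ys (s≤s p) = drop-++ˡ n xs ys p

  unique⇒allPairs-¬ : {R : A → A → Set} {xs : List A} →
    (∀ {x y} → x ∈ xs → y ∈ xs → R x y → x ≡ y) → Unique xs → AllPairs (λ x y → ¬ R x y) xs
  unique⇒allPairs-¬ R⇒≡ []           = []
  unique⇒allPairs-¬ R⇒≡ (x∉xs ∷ xs!) =
    All.tabulate (λ y∈xs Rxy → All.lookup x∉xs y∈xs (R⇒≡ (here refl) (there y∈xs) Rxy))
    ∷ unique⇒allPairs-¬ (λ x∈ y∈ → R⇒≡ (there x∈) (there y∈)) xs!

module _ {A B : Set} where

  length-≡-by-bijection : (f : A → B) {xs : List A} {ys : List B} → Unique xs → Unique ys →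
    (∀ {x x′} → x ∈ xs → x′ ∈ xs → f x ≡ f x′ → x ≡ x′) →
    (∀ {x} → x ∈ xs → f x ∈ ys) →
    (∀ {y} → y ∈ ys → ∃ λ x → x ∈ xs × f x ≡ y) →
    length xs ≡ length ys
  length-≡-by-bijection f {xs} {ys} xs! ys! inj into onto = begin
    length xs         ≡⟨ length-map f xs ⟨
    length (map f xs) ≡⟨ ↭-length (∼bag⇒↭ (unique∧set⇒bag fxs! ys! (mk⇔ to from))) ⟩
    length ys         ∎
    where
    open ≡-Reasoning
    fxs! : Unique (map f xs)
    fxs! = AllPairs.map⁺ (unique⇒allPairs-¬ inj xs!)
    to : ∀ {y} → y ∈ map f xs → y ∈ ys
    to y∈ with ∈-map⁻ f y∈
    ... | x , x∈ , refl = into x∈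
    from : ∀ {y} → y ∈ ys → y ∈ map f xs
    from y∈ with onto y∈
    ... | x , x∈ , refl = ∈-map⁺ f x∈

  length-cartesianProduct : (xs : List A) (ys : List B) →
    length (cartesianProduct xs ys) ≡ length xs * length ys
  length-cartesianProduct []       ys = refl
  length-cartesianProduct (x ∷ xs) ys = begin
    length (map (x ,_) ys ++ cartesianProduct xs ys)          ≡⟨ length-++ (map (x ,_) ys) ⟩
    length (map (x ,_) ys) + length (cartesianProduct xs ys)  ≡⟨ cong₂ _+_ (length-map _ ys) (length-cartesianProduct xs ys) ⟩
    length ys + length xs * length ys                         ∎
    where open ≡-Reasoning

-- Rotations

rotate-↭ : (c : List ℕ) → rotate c ↭ c
rotate-↭ []      = ↭-refl
rotate-↭ (x ∷ c) = ↭-sym (∷↭∷ʳ x c)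

rotateN-↭ : ∀ i (c : List ℕ) → rotateN i c ↭ c
rotateN-↭ zero    c = ↭-refl
rotateN-↭ (suc i) c = ↭-trans (rotateN-↭ i (rotate c)) (rotate-↭ c)

length-rotateN : ∀ i (c : List ℕ) → length (rotateN i c) ≡ length c
length-rotateN i c = ↭-length (rotateN-↭ i c)

rotateN-+ : ∀ i j (c : List ℕ) → rotateN (i + j) c ≡ rotateN j (rotateN i c)
rotateN-+ zero    j c = refl
rotateN-+ (suc i) j c = rotateN-+ i j (rotate c)

rotateN-drop-take : ∀ i (c : List ℕ) → i ≤ length c → rotateN i c ≡ drop i c ++ take i c
rotateN-drop-take zero    c       _       = sym (++-identityʳ c)
rotateN-drop-take (suc i) (x ∷ c) (s≤s p) = begin
  rotateN i (c ++ x ∷ [])                        ≡⟨ rotateN-drop-take i (c ++ x ∷ []) i≤ ⟩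
  drop i (c ++ x ∷ []) ++ take i (c ++ x ∷ [])   ≡⟨ cong₂ _++_ (drop-++ˡ i c _ p) (take-++ˡ i c _ p) ⟩
  (drop i c ++ x ∷ []) ++ take i c               ≡⟨ ++-assoc (drop i c) (x ∷ []) (take i c) ⟩
  drop i c ++ x ∷ take i c                       ∎
  where
  open ≡-Reasoning
  i≤ : i ≤ length (c ++ x ∷ [])
  i≤ = subst (i ≤_) (sym (length-++ c)) (≤-trans p (m≤m+n (length c) 1))

rotateN-length-id : (c : List ℕ) → rotateN (length c) c ≡ c
rotateN-length-id c = begin
  rotateN (length c) c                      ≡⟨ rotateN-drop-take (length c) c ≤-refl ⟩
  drop (length c) c ++ take (length c) c    ≡⟨ cong₂ _++_ (drop-all (length c) c ≤-refl) (take-all (length c) c ≤-refl) ⟩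
  c                                         ∎
  where open ≡-Reasoning

rotateN-*-length-id : ∀ q (c : List ℕ) → rotateN (q * length c) c ≡ c
rotateN-*-length-id zero    c = refl
rotateN-*-length-id (suc q) c = begin
  rotateN (length c + q * length c) c             ≡⟨ rotateN-+ (length c) (q * length c) c ⟩
  rotateN (q * length c) (rotateN (length c) c)   ≡⟨ cong (rotateN (q * length c)) (rotateN-length-id c) ⟩
  rotateN (q * length c) c                        ≡⟨ rotateN-*-length-id q c ⟩
  c                                               ∎
  where open ≡-Reasoning

rotateN-% : ∀ i (c : List ℕ) {n} → length c ≡ suc n → rotateN i c ≡ rotateN (i % suc n) c
rotateN-% i c {n} len = begin
  rotateN i c                                     ≡⟨ cong (λ j → rotateN j c) (m≡m%n+[m/n]*n i (suc n)) ⟩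
  rotateN (i % suc n + i / suc n * suc n) c       ≡⟨ rotateN-+ (i % suc n) _ c ⟩
  rotateN (i / suc n * suc n) (rotateN (i % suc n) c)
      ≡⟨ cong (λ l → rotateN (i / suc n * l) (rotateN (i % suc n) c)) (trans (length-rotateN (i % suc n) c) len) ⟨
  rotateN (i / suc n * length (rotateN (i % suc n) c)) (rotateN (i % suc n) c)
      ≡⟨ rotateN-*-length-id (i / suc n) _ ⟩
  rotateN (i % suc n) c                           ∎
  where open ≡-Reasoning

rotateN-window : ∀ i c → i ≤ length c → rotateN i c ≡ take (length c) (drop i (c ++ c))
rotateN-window i c i≤ = begin
  rotateN i c                                      ≡⟨ rotateN-drop-take i c i≤ ⟩
  drop i c ++ take i c                             ≡⟨ take-++-length i (drop i c) c ⟨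
  take (length (drop i c) + i) (drop i c ++ c)     ≡⟨ cong₂ take (sym length-eq) (drop-++ˡ i c c i≤) ⟨
  take (length c) (drop i (c ++ c))                ∎
  where
  open ≡-Reasoning
  length-eq : length (drop i c) + i ≡ length c
  length-eq = trans (cong (_+ i) (length-drop i c)) (m∸n+n≡m i≤)

take-rotateN : ∀ i u c → i ≤ length c → u ≤ length c →
  take u (rotateN i c) ≡ take u (drop i (c ++ c))
take-rotateN i u c i≤ u≤ = begin
  take u (rotateN i c)                              ≡⟨ cong (take u) (rotateN-window i c i≤) ⟩
  take u (take (length c) (drop i (c ++ c)))        ≡⟨ take-take u (length c) _ ⟩
  take (u ⊓ length c) (drop i (c ++ c))             ≡⟨ cong (λ v → take v (drop i (c ++ c))) (m≤n⇒m⊓n≡m u≤) ⟩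
  take u (drop i (c ++ c))                          ∎
  where open ≡-Reasoning

-- Compositions

CompositionWith : ℕ → ℕ → ℕ → List ℕ → Set
CompositionWith n k m c = IsComposition n k c × partsAtLeast2 c ≡ m

compositionWith-rotateN : ∀ {n k m} i {c} → CompositionWith n k m c → CompositionWith n k m (rotateN i c)
compositionWith-rotateN i {c} ((pos , len , total) , big) =
  (All-resp-↭ (↭-sym ↭c) pos , trans (↭-length ↭c) len , trans (sum-↭ ↭c) total) ,
  trans (↭-length (filter-↭ (2 ≤?_) ↭c)) big
  where
  ↭c : rotateN i c ↭ c
  ↭c = rotateN-↭ i c

incrementHead : List ℕ → List ℕ
incrementHead []       = []
incrementHead (x ∷ xs) = suc x ∷ xs

-- Compositions into k parts are indexed by the excess s of their sum over k, so that the
-- recursion never subtracts; compositionsHead≥2 k s m are those in compositions (suc k) s m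
-- whose first part is at least 2.
compositions       : ℕ → ℕ → ℕ → List (List ℕ)
compositionsHead≥2 : ℕ → ℕ → ℕ → List (List ℕ)

compositions zero    zero    zero    = [] ∷ []
compositions zero    zero    (suc m) = []
compositions zero    (suc s) m       = []
compositions (suc k) s       m       = map (1 ∷_) (compositions k s m) ++ compositionsHead≥2 k s m

compositionsHead≥2 k (suc s) (suc m) =
  map (2 ∷_) (compositions k s m) ++ map incrementHead (compositionsHead≥2 k s (suc m))
compositionsHead≥2 k _       _       = []

compositionCount : ℕ → ℕ → ℕ → ℕ
compositionCount k zero    zero    = 1
compositionCount k zero    (suc m) = 0
compositionCount k (suc s) zero    = 0
compositionCount k (suc s) (suc m) = (k C suc m) * (s C m)

compositionHead≥2Count : ℕ → ℕ → ℕ → ℕ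
compositionHead≥2Count k (suc s) (suc m) = (k C m) * (s C m)
compositionHead≥2Count k _       _       = 0

compositionsHead≥2-head : ∀ k s m {c} → c ∈ compositionsHead≥2 k s m → ∃₂ λ h t → c ≡ 2 + h ∷ t
compositionsHead≥2-head k (suc s) (suc m) c∈ with ∈-++⁻ (map (2 ∷_) (compositions k s m)) c∈
... | inj₁ c∈₁ with ∈-map⁻ _ c∈₁
...   | t , _ , refl = 0 , t , refl
compositionsHead≥2-head k (suc s) (suc m) c∈ | inj₂ c∈₂ with ∈-map⁻ _ c∈₂
...   | c′ , c′∈ , refl with compositionsHead≥2-head k s (suc m) c′∈
...     | h , t , refl = suc h , t , refl

compositions-sound       : ∀ k s m {c} → c ∈ compositions k s m → CompositionWith (k + s) k m c
compositionsHead≥2-sound : ∀ k s m {c} → c ∈ compositionsHead≥2 k s m →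
                           CompositionWith (suc k + s) (suc k) m c

compositions-sound zero zero zero (here refl) = ([] , refl , refl) , refl
compositions-sound (suc k) s m c∈ with ∈-++⁻ (map (1 ∷_) (compositions k s m)) c∈
... | inj₂ c∈₂ = compositionsHead≥2-sound k s m c∈₂
... | inj₁ c∈₁ with ∈-map⁻ _ c∈₁
...   | t , t∈ , refl with compositions-sound k s m t∈
...     | (pos , len , total) , big = (s≤s z≤n ∷ pos , cong suc len , cong suc total) , big

compositionsHead≥2-sound k (suc s) (suc m) c∈ with ∈-++⁻ (map (2 ∷_) (compositions k s m)) c∈
... | inj₁ c∈₁ with ∈-map⁻ _ c∈₁
...   | t , t∈ , refl with compositions-sound k s m t∈
...     | (pos , len , total) , big =
  (s≤s z≤n ∷ pos , cong suc len , trans (cong (2 +_) total) (cong suc (sym (+-suc k s)))) , cong suc big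
compositionsHead≥2-sound k (suc s) (suc m) c∈ | inj₂ c∈₂ with ∈-map⁻ _ c∈₂
...   | c′ , c′∈ , refl with compositionsHead≥2-head k s (suc m) c′∈ | compositionsHead≥2-sound k s (suc m) c′∈
...     | h , t , refl | (pos , len , total) , big =
  (s≤s z≤n ∷ All.tail pos , len , trans (cong suc total) (cong suc (sym (+-suc k s)))) , big

length≤sum : ∀ {c} → All (1 ≤_) c → length c ≤ sum c
length≤sum []         = z≤n
length≤sum (p ∷ pos) = +-mono-≤ p (length≤sum pos)

compositions-complete       : ∀ k s m {c} → CompositionWith (k + s) k m c → c ∈ compositions k s m
compositionsHead≥2-complete : ∀ k s m h t → CompositionWith (suc k + s) (suc k) m (2 + h ∷ t) →
                              2 + h ∷ t ∈ compositionsHead≥2 k s m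

compositions-complete zero    zero    zero    {[]}    _                 = here refl
compositions-complete zero    zero    (suc m) {[]}    (_ , ())
compositions-complete zero    (suc s) m       {[]}    ((_ , _ , ()) , _)
compositions-complete zero    s       m       {_ ∷ _} ((_ , () , _) , _)
compositions-complete (suc k) s       m       {[]}    ((_ , () , _) , _)
compositions-complete (suc k) s m {suc zero ∷ t} ((_ ∷ pos , len , total) , big) =
  ∈-++⁺ˡ (∈-map⁺ _ (compositions-complete k s m ((pos , suc-injective len , suc-injective total) , big)))
compositions-complete (suc k) s m {suc (suc h) ∷ t} comp =
  ∈-++⁺ʳ _ (compositionsHead≥2-complete k s m h t comp)

compositionsHead≥2-complete k zero m h t ((_ ∷ pos , len , total) , _) =
  ⊥-elim (<⇒≱ (begin-strict
    suc k + 0          ≡⟨ +-identityʳ (suc k) ⟩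
    suc k              ≡⟨ len ⟨
    suc (length t)     ≤⟨ s≤s (length≤sum pos) ⟩
    suc (sum t)        <⟨ s≤s (s≤s (m≤n+m (sum t) h)) ⟩
    2 + h + sum t      ∎) (≤-reflexive total))
  where open ≤-Reasoning
compositionsHead≥2-complete k (suc s) zero    h t (_ , ())
compositionsHead≥2-complete k (suc s) (suc m) zero t ((_ ∷ pos , len , total) , big) =
  ∈-++⁺ˡ (∈-map⁺ _ (compositions-complete k s m
    ((pos , suc-injective len , suc-injective (suc-injective (trans total (cong suc (+-suc k s))))) , suc-injective big)))
compositionsHead≥2-complete k (suc s) (suc m) (suc h) t ((_ ∷ pos , len , total) , big) =
  ∈-++⁺ʳ _ (∈-map⁺ incrementHead (compositionsHead≥2-complete k s (suc m) h t
    ((s≤s z≤n ∷ pos , len , suc-injective (trans total (cong suc (+-suc k s)))) , big)))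

incrementHead-injective : ∀ {c c′} → incrementHead c ≡ incrementHead c′ → c ≡ c′
incrementHead-injective {[]}    {[]}    _    = refl
incrementHead-injective {_ ∷ _} {_ ∷ _} refl = refl

compositions-unique       : ∀ k s m → Unique (compositions k s m)
compositionsHead≥2-unique : ∀ k s m → Unique (compositionsHead≥2 k s m)

compositions-unique zero    zero    zero    = [] ∷ []
compositions-unique zero    zero    (suc m) = []
compositions-unique zero    (suc s) m       = []
compositions-unique (suc k) s       m       =
  Unique.++⁺ (Unique.map⁺ ∷-injectiveʳ (compositions-unique k s m)) (compositionsHead≥2-unique k s m) disjoint
  where
  disjoint : Disjoint (map (1 ∷_) (compositions k s m)) (compositionsHead≥2 k s m)
  disjoint (c∈₁ , c∈₂) with ∈-map⁻ _ c∈₁ | compositionsHead≥2-head k s m c∈₂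
  ... | _ , _ , refl | _ , _ , ()

compositionsHead≥2-unique k zero    m       = []
compositionsHead≥2-unique k (suc s) zero    = []
compositionsHead≥2-unique k (suc s) (suc m) =
  Unique.++⁺ (Unique.map⁺ ∷-injectiveʳ (compositions-unique k s m))
             (Unique.map⁺ incrementHead-injective (compositionsHead≥2-unique k s (suc m))) disjoint
  where
  disjoint : Disjoint (map (2 ∷_) (compositions k s m)) (map incrementHead (compositionsHead≥2 k s (suc m)))
  disjoint (c∈₁ , c∈₂) with ∈-map⁻ _ c∈₁ | ∈-map⁻ _ c∈₂
  ... | _ , _ , refl | c′ , c′∈ , eq with compositionsHead≥2-head k s (suc m) c′∈
  ...   | _ , _ , refl with eq
  ...     | ()

compositionCount-suc : ∀ k s m →
  compositionCount k s m + compositionHead≥2Count k s m ≡ compositionCount (suc k) s m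
compositionCount-suc k zero    zero    = refl
compositionCount-suc k zero    (suc m) = refl
compositionCount-suc k (suc s) zero    = refl
compositionCount-suc k (suc s) (suc m) = begin
  (k C suc m) * (s C m) + (k C m) * (s C m)   ≡⟨ *-distribʳ-+ (s C m) (k C suc m) (k C m) ⟨
  ((k C suc m) + (k C m)) * (s C m)           ≡⟨ cong (_* (s C m)) (+-comm (k C suc m) (k C m)) ⟩
  ((k C m) + (k C suc m)) * (s C m)           ≡⟨ cong (_* (s C m)) (nCk+nC[k+1]≡[n+1]C[k+1] k m) ⟩
  (suc k C suc m) * (s C m)                   ∎
  where open ≡-Reasoning

compositionHead≥2Count-suc : ∀ k s m →
  compositionCount k s m + compositionHead≥2Count k s (suc m) ≡ compositionHead≥2Count k (suc s) (suc m)
compositionHead≥2Count-suc k zero    zero    = refl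
compositionHead≥2Count-suc k zero    (suc m) = sym (*-zeroʳ (k C suc m))
compositionHead≥2Count-suc k (suc s) zero    = refl
compositionHead≥2Count-suc k (suc s) (suc m) = begin
  (k C suc m) * (s C m) + (k C suc m) * (s C suc m)   ≡⟨ *-distribˡ-+ (k C suc m) (s C m) (s C suc m) ⟨
  (k C suc m) * ((s C m) + (s C suc m))               ≡⟨ cong ((k C suc m) *_) (nCk+nC[k+1]≡[n+1]C[k+1] s m) ⟩
  (k C suc m) * (suc s C suc m)                       ∎
  where open ≡-Reasoning

length-compositions       : ∀ k s m → length (compositions k s m) ≡ compositionCount k s m
length-compositionsHead≥2 : ∀ k s m → length (compositionsHead≥2 k s m) ≡ compositionHead≥2Count k s m

length-compositions zero    zero    zero    = refl
length-compositions zero    zero    (suc m) = refl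
length-compositions zero    (suc s) zero    = refl
length-compositions zero    (suc s) (suc m) = sym (*-zeroˡ (s C m))
length-compositions (suc k) s       m       = begin
  length (map (1 ∷_) (compositions k s m) ++ compositionsHead≥2 k s m)
    ≡⟨ length-++ (map (1 ∷_) (compositions k s m)) ⟩
  length (map (1 ∷_) (compositions k s m)) + length (compositionsHead≥2 k s m)
    ≡⟨ cong₂ _+_ (trans (length-map _ (compositions k s m)) (length-compositions k s m))
                 (length-compositionsHead≥2 k s m) ⟩
  compositionCount k s m + compositionHead≥2Count k s m
    ≡⟨ compositionCount-suc k s m ⟩
  compositionCount (suc k) s m ∎
  where open ≡-Reasoning

length-compositionsHead≥2 k zero    m       = refl
length-compositionsHead≥2 k (suc s) zero    = refl
length-compositionsHead≥2 k (suc s) (suc m) = begin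
  length (map (2 ∷_) (compositions k s m) ++ map incrementHead (compositionsHead≥2 k s (suc m)))
    ≡⟨ length-++ (map (2 ∷_) (compositions k s m)) ⟩
  length (map (2 ∷_) (compositions k s m)) + length (map incrementHead (compositionsHead≥2 k s (suc m)))
    ≡⟨ cong₂ _+_ (trans (length-map _ (compositions k s m)) (length-compositions k s m))
                 (trans (length-map _ (compositionsHead≥2 k s (suc m))) (length-compositionsHead≥2 k s (suc m))) ⟩
  compositionCount k s m + compositionHead≥2Count k s (suc m)
    ≡⟨ compositionHead≥2Count-suc k s m ⟩
  compositionHead≥2Count k (suc s) (suc m) ∎
  where open ≡-Reasoning

-- The cycle lemma

+-<-exchange : ∀ {a b x y} → a + y ≡ b + x → y < x ⇔ b < a
+-<-exchange {a} {b} {x} {y} eq = mk⇔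
  (λ y<x → +-cancelʳ-< y b a (subst (b + y <_) (sym eq) (+-monoʳ-< b y<x)))
  (λ b<a → +-cancelˡ-< b y x (subst (b + y <_) eq (+-monoˡ-< y b<a)))

lastMinimum : (f : ℕ → ℕ) (n : ℕ) →
  ∃ λ i → i ≤ n × (∀ {j} → j ≤ n → f i ≤ f j) × (∀ {j} → i < j → j ≤ n → f i < f j)
lastMinimum f zero = 0 , z≤n , (λ { z≤n → ≤-refl }) , (λ { 0<j z≤n → ⊥-elim (<-irrefl refl 0<j) })
lastMinimum f (suc n) with lastMinimum f n
... | i , i≤n , min , last with f (suc n) ≤? f i
... | yes fn≤fi = suc n , ≤-refl , min′ , (λ n<j j≤n → ⊥-elim (<-irrefl refl (≤-trans n<j j≤n)))
  where
  min′ : ∀ {j} → j ≤ suc n → f (suc n) ≤ f j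
  min′ j≤ with m≤n⇒m<n∨m≡n j≤
  ... | inj₁ j<  = ≤-trans fn≤fi (min (s≤s⁻¹ j<))
  ... | inj₂ refl = ≤-refl
... | no fn≰fi = i , m≤n⇒m≤1+n i≤n , min′ , last′
  where
  min′ : ∀ {j} → j ≤ suc n → f i ≤ f j
  min′ j≤ with m≤n⇒m<n∨m≡n j≤
  ... | inj₁ j<  = min (s≤s⁻¹ j<)
  ... | inj₂ refl = <⇒≤ (≰⇒> fn≰fi)
  last′ : ∀ {j} → i < j → j ≤ suc n → f i < f j
  last′ i<j j≤ with m≤n⇒m<n∨m≡n j≤
  ... | inj₁ j<  = last i<j (s≤s⁻¹ j<)
  ... | inj₂ refl = ≰⇒> fn≰fi

module CycleLemma (r : ℕ) where

  Dominating : List ℕ → Set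
  Dominating xs = ∀ {t} → t < length xs → r * suc t < sum (take (suc t) xs)

  dominating? : (xs : List ℕ) → Dec (Dominating xs)
  dominating? xs = allUpTo? (λ t → r * suc t <? sum (take (suc t) xs)) (length xs)

  Balanced : List ℕ → Set
  Balanced xs = sum xs ≡ r * length xs + 1

  Balanced-resp-↭ : ∀ {a b} → a ↭ b → Balanced a → Balanced b
  Balanced-resp-↭ a↭b bal = trans (sym (sum-↭ a↭b)) (trans bal (cong (λ l → r * l + 1) (↭-length a↭b)))

  -- The walk r * length xs + Σ_{i<j} (xs_i - r), written so that it stays in ℕ.
  height : List ℕ → ℕ → ℕ
  height xs j = sum (take j xs) + r * length (drop j xs)

  height-+ : ∀ xs i u → i + u ≤ length xs →
    height xs (i + u) + r * u ≡ height xs i + sum (take u (drop i xs))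
  height-+ xs i u i+u≤ = begin
    sum (take (i + u) xs) + r * L + r * u  ≡⟨ cong (λ s → s + r * L + r * u) sum-take-+ ⟩
    S + X + r * L + r * u                  ≡⟨ rearrange r S X L u ⟩
    S + r * (u + L) + X                    ≡⟨ cong (λ l → S + r * l + X) length-drop-i ⟨
    S + r * length (drop i xs) + X         ∎
    where
    open ≡-Reasoning
    S X L : ℕ
    S = sum (take i xs)
    X = sum (take u (drop i xs))
    L = length (drop (i + u) xs)
    rearrange : ∀ r S X L u → S + X + r * L + r * u ≡ S + r * (u + L) + X
    rearrange = solve-∀
    sum-take-+ : sum (take (i + u) xs) ≡ S + X
    sum-take-+ = trans (cong sum (take-+ i u xs)) (sum-++ (take i xs) _)
    length-drop-i : length (drop i xs) ≡ u + L
    length-drop-i = begin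
      length (drop i xs)                                   ≡⟨ length-drop i xs ⟩
      length xs ∸ i                                        ≡⟨ cong (_∸ i) (m+[n∸m]≡n i+u≤) ⟨
      i + u + (length xs ∸ (i + u)) ∸ i                    ≡⟨ cong (_∸ i) (+-assoc i u _) ⟩
      i + (u + (length xs ∸ (i + u))) ∸ i                  ≡⟨ m+n∸m≡n i _ ⟩
      u + (length xs ∸ (i + u))                            ≡⟨ cong (u +_) (length-drop (i + u) xs) ⟨
      u + L                                                ∎

  rise⇔height< : ∀ xs i u → i + u ≤ length xs →
    r * u < sum (take u (drop i xs)) ⇔ height xs i < height xs (i + u)
  rise⇔height< xs i u i+u≤ = +-<-exchange (height-+ xs i u i+u≤)

  -- Writing cc = c ++ c, the rotation by i is the window of cc starting at i, so its prefix
  -- sums are increments of the height along cc.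
  rotateN-dominating⇔ : ∀ c i → i ≤ length c →
    Dominating (rotateN i c) ⇔ (∀ {t} → t < length c → height (c ++ c) i < height (c ++ c) (i + suc t))
  rotateN-dominating⇔ c i i≤ = mk⇔
    (λ dom {_} t< → Equivalence.to (prefix⇔rise t<) (dom (subst (_ <_) (sym len) t<)))
    (λ rises {_} t< → Equivalence.from (prefix⇔rise (subst (_ <_) len t<)) (rises (subst (_ <_) len t<)))
    where
    len : length (rotateN i c) ≡ length c
    len = length-rotateN i c
    prefix⇔rise : ∀ {t} → t < length c →
      r * suc t < sum (take (suc t) (rotateN i c)) ⇔ height (c ++ c) i < height (c ++ c) (i + suc t)
    prefix⇔rise {t} t< =
      subst (λ s → r * suc t < s ⇔ height (c ++ c) i < height (c ++ c) (i + suc t))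
            (cong sum (sym (take-rotateN i (suc t) c i≤ t<)))
            (rise⇔height< (c ++ c) i (suc t) (subst (i + suc t ≤_) (sym (length-++ c)) (+-mono-≤ i≤ t<)))

  height-period : ∀ c j → Balanced c → j ≤ length c →
    height (c ++ c) (j + length c) ≡ suc (height (c ++ c) j)
  height-period c j bal j≤ = +-cancelʳ-≡ (r * length c) _ _ (begin
    height (c ++ c) (j + length c) + r * length c          ≡⟨ height-+ (c ++ c) j (length c) j+L≤ ⟩
    height (c ++ c) j + sum (take (length c) (drop j (c ++ c)))
      ≡⟨ cong (λ w → height (c ++ c) j + sum w) (rotateN-window j c j≤) ⟨
    height (c ++ c) j + sum (rotateN j c)
      ≡⟨ cong (height (c ++ c) j +_) (trans (sum-↭ (rotateN-↭ j c)) bal) ⟩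
    height (c ++ c) j + (r * length c + 1)                 ≡⟨ +-assoc (height (c ++ c) j) _ 1 ⟨
    height (c ++ c) j + r * length c + 1                   ≡⟨ +-comm _ 1 ⟩
    suc (height (c ++ c) j) + r * length c                 ∎)
    where
    open ≡-Reasoning
    j+L≤ : j + length c ≤ length (c ++ c)
    j+L≤ = subst (j + length c ≤_) (sym (length-++ c)) (+-monoˡ-≤ (length c) j≤)

  -- Start at the last minimum of the height over one period: later in the period the height is
  -- strictly larger, and in the next period it exceeds the minimum by at least one.
  dominating-rotation : ∀ c → Balanced c → 0 < length c → ∃ λ i → i < length c × Dominating (rotateN i c)
  dominating-rotation []           _   ()
  dominating-rotation c@(_ ∷ xs) bal _ with lastMinimum (height (c ++ c)) (length xs)
  ... | i , i≤n , minimal , last =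
    i , s≤s i≤n , Equivalence.from (rotateN-dominating⇔ c i (m≤n⇒m≤1+n i≤n)) rises
    where
    rises : ∀ {t} → t < length c → height (c ++ c) i < height (c ++ c) (i + suc t)
    rises {t} t< with i + suc t <? length c
    ... | yes inside = last (m<m+n i z<s) (s≤s⁻¹ inside)
    ... | no outside = begin-strict
      height (c ++ c) i                 ≤⟨ minimal (s≤s⁻¹ j<L) ⟩
      height (c ++ c) j                 <⟨ n<1+n _ ⟩
      suc (height (c ++ c) j)           ≡⟨ height-period c j bal (<⇒≤ j<L) ⟨
      height (c ++ c) (j + length c)    ≡⟨ cong (height (c ++ c)) wrap ⟩
      height (c ++ c) (i + suc t)       ∎
      where
      open ≤-Reasoning
      j : ℕ
      j = i + suc t ∸ length c
      wrap : j + length c ≡ i + suc t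
      wrap = m∸n+n≡m (≮⇒≥ outside)
      j<L : j < length c
      j<L = +-cancelʳ-< (length c) j (length c)
              (subst (_< length c + length c) (sym wrap) (+-mono-<-≤ (s≤s i≤n) t<))

  -- If both c and its rotation by d = 1 + d′ were dominating, the height would rise strictly from
  -- 0 to d and again from d to the end of the period, i.e. by at least 2 over a period; but it rises by 1.
  dominating-rotateN-trivial : ∀ c d → Balanced c → d < length c →
    Dominating c → Dominating (rotateN d c) → d ≡ 0
  dominating-rotateN-trivial c zero     bal d<L domc domd = refl
  dominating-rotateN-trivial c (suc d′) bal d<L domc domd with m≤n⇒∃[o]m+o≡n d<L
  ... | t , d+t≡L = ⊥-elim (<⇒≱ start-to-d (s≤s⁻¹ (begin-strict
    height (c ++ c) d                 <⟨ d-to-end ⟩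
    height (c ++ c) (d + suc t)       ≡⟨ cong (height (c ++ c)) (trans (+-suc d t) d+t≡L) ⟩
    height (c ++ c) (0 + length c)    ≡⟨ height-period c 0 bal z≤n ⟩
    suc (height (c ++ c) 0)           ∎)))
    where
    open ≤-Reasoning
    d : ℕ
    d = suc d′
    start-to-d : height (c ++ c) 0 < height (c ++ c) d
    start-to-d = Equivalence.to (rotateN-dominating⇔ c 0 z≤n) domc (<-trans (n<1+n d′) d<L)
    d-to-end : height (c ++ c) d < height (c ++ c) (d + suc t)
    d-to-end = Equivalence.to (rotateN-dominating⇔ c d (<⇒≤ d<L)) domd
                 (subst (t <_) d+t≡L (m<n+m t z<s))

  private
    rotateN-injective-≤ : ∀ {a b i j} → Balanced a → length b ≡ length a → Dominating a → Dominating b →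
      i ≤ j → j < length a → rotateN i a ≡ rotateN j b → i ≡ j × a ≡ b
    rotateN-injective-≤ {a} {b} {i} {j} bal lb doma domb i≤j j<L eq =
      [ partial , full ]′ (m≤n⇒m<n∨m≡n d≤L)
      where
      L d : ℕ
      L = length a
      d = i + (L ∸ j)
      j+[L∸j]≡L : j + (L ∸ j) ≡ L
      j+[L∸j]≡L = m+[n∸m]≡n (<⇒≤ j<L)
      d≤L : d ≤ L
      d≤L = subst (d ≤_) j+[L∸j]≡L (+-monoˡ-≤ (L ∸ j) i≤j)
      rotated : rotateN d a ≡ b
      rotated = begin
        rotateN (i + (L ∸ j)) a           ≡⟨ rotateN-+ i (L ∸ j) a ⟩
        rotateN (L ∸ j) (rotateN i a)     ≡⟨ cong (rotateN (L ∸ j)) eq ⟩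
        rotateN (L ∸ j) (rotateN j b)     ≡⟨ rotateN-+ j (L ∸ j) b ⟨
        rotateN (j + (L ∸ j)) b           ≡⟨ cong (λ e → rotateN e b) (trans j+[L∸j]≡L (sym lb)) ⟩
        rotateN (length b) b              ≡⟨ rotateN-length-id b ⟩
        b                                 ∎
        where open ≡-Reasoning
      partial : d < L → i ≡ j × a ≡ b
      partial d<L = ⊥-elim (<⇒≱ j<L (m∸n≡0⇒m≤n (m+n≡0⇒n≡0 i
        (dominating-rotateN-trivial a d bal d<L doma (subst Dominating (sym rotated) domb)))))
      full : d ≡ L → i ≡ j × a ≡ b
      full d≡L = +-cancelʳ-≡ (L ∸ j) i j (trans d≡L (sym j+[L∸j]≡L)) , (begin
        a               ≡⟨ rotateN-length-id a ⟨
        rotateN L a     ≡⟨ cong (λ e → rotateN e a) d≡L ⟨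
        rotateN d a     ≡⟨ rotated ⟩
        b               ∎)
        where open ≡-Reasoning

  rotateN-injective : ∀ {a b i j} → Balanced a → Dominating a → Dominating b →
    i < length a → j < length a → rotateN i a ≡ rotateN j b → i ≡ j × a ≡ b
  rotateN-injective {a} {b} {i} {j} bal doma domb i<L j<L eq = [ aligned , swapped ]′ (≤-total i j)
    where
    a↭b : a ↭ b
    a↭b = ↭-trans (↭-sym (rotateN-↭ i a)) (subst (_↭ b) (sym eq) (rotateN-↭ j b))
    lb : length b ≡ length a
    lb = sym (↭-length a↭b)
    aligned : i ≤ j → i ≡ j × a ≡ b
    aligned i≤j = rotateN-injective-≤ bal lb doma domb i≤j j<L eq
    swapped : j ≤ i → i ≡ j × a ≡ b
    swapped j≤i = Product.map sym sym (rotateN-injective-≤ (Balanced-resp-↭ a↭b bal) (sym lb)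
                    domb doma j≤i (subst (i <_) (sym lb) i<L) (sym eq))

-- Cyclic classes

narayana≡compositionCount/ : ∀ n m → narayana (suc n) m ≡ compositionCount (suc n) (suc (suc n)) m / suc n
narayana≡compositionCount/ n zero    = refl
narayana≡compositionCount/ n (suc m) = refl

k+[1+k]≡2k+1 : ∀ k → k + suc k ≡ 2 * k + 1
k+[1+k]≡2k+1 = solve-∀

module Representatives (n m : ℕ) where

  open CycleLemma 2

  k : ℕ
  k = suc n

  Admissible : List ℕ → Set
  Admissible = CompositionWith (2 * k + 1) k m

  admissible : List (List ℕ)
  admissible = compositions k (suc k) m

  ∈-admissible⁺ : ∀ {c} → Admissible c → c ∈ admissible
  ∈-admissible⁺ ((pos , len , total) , big) =
    compositions-complete k (suc k) m ((pos , len , trans total (sym (k+[1+k]≡2k+1 k))) , big)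

  ∈-admissible⁻ : ∀ {c} → c ∈ admissible → Admissible c
  ∈-admissible⁻ c∈ with compositions-sound k (suc k) m c∈
  ... | (pos , len , total) , big = (pos , len , trans total (k+[1+k]≡2k+1 k)) , big

  admissible-balanced : ∀ {c} → Admissible c → Balanced c
  admissible-balanced ((_ , len , total) , _) = trans total (cong (λ l → 2 * l + 1) (sym len))

  representatives : List (List ℕ)
  representatives = filter dominating? admissible

  ∈-representatives⁻ : ∀ {c} → c ∈ representatives → Admissible c × Dominating c
  ∈-representatives⁻ c∈ with ∈-filter⁻ dominating? {xs = admissible} c∈
  ... | c∈adm , dom = ∈-admissible⁻ c∈adm , dom

  ∈-representatives⁺ : ∀ {c} → Admissible c → Dominating c → c ∈ representatives
  ∈-representatives⁺ adm dom = ∈-filter⁺ dominating? (∈-admissible⁺ adm) dom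

  representatives-unique : Unique representatives
  representatives-unique = Unique.filter⁺ dominating? (compositions-unique k (suc k) m)

  dominating-rotation-of : ∀ {c} → Admissible c → ∃ λ i → i < k × rotateN i c ∈ representatives
  dominating-rotation-of {c} adm@((_ , len , _) , _)
    with dominating-rotation c (admissible-balanced adm) (subst (0 <_) (sym len) z<s)
  ... | i , i< , dom = i , subst (i <_) len i< , ∈-representatives⁺ (compositionWith-rotateN i adm) dom

  rotation : ℕ × List ℕ → List ℕ
  rotation (i , c) = rotateN i c

  rotations : List (ℕ × List ℕ)
  rotations = cartesianProduct (upTo k) representatives

  rotation-injective : ∀ {x y} → x ∈ rotations → y ∈ rotations → rotation x ≡ rotation y → x ≡ y
  rotation-injective {i , a} {j , b} x∈ y∈ eq
    with ∈-cartesianProduct⁻ (upTo k) representatives x∈ | ∈-cartesianProduct⁻ (upTo k) representatives y∈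
  ... | i∈ , a∈ | j∈ , b∈ with ∈-representatives⁻ a∈ | ∈-representatives⁻ b∈
  ...   | adm@((_ , len , _) , _) , doma | _ , domb
    with rotateN-injective (admissible-balanced adm) doma domb
           (subst (i <_) (sym len) (∈-upTo⁻ i∈)) (subst (j <_) (sym len) (∈-upTo⁻ j∈)) eq
  ...     | refl , refl = refl

  rotation-admissible : ∀ {x} → x ∈ rotations → rotation x ∈ admissible
  rotation-admissible {i , a} x∈ with ∈-cartesianProduct⁻ (upTo k) representatives x∈
  ... | _ , a∈ = ∈-admissible⁺ (compositionWith-rotateN i (proj₁ (∈-representatives⁻ a∈)))

  rotation-onto : ∀ {c} → c ∈ admissible → ∃ λ x → x ∈ rotations × rotation x ≡ c
  rotation-onto {c} c∈ with dominating-rotation-of (∈-admissible⁻ c∈)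
  ... | i , i<k , r∈ =
    ((k ∸ i) % k , rotateN i c) , ∈-cartesianProduct⁺ (∈-upTo⁺ (m%n<n (k ∸ i) k)) r∈ , (begin
    rotateN ((k ∸ i) % k) (rotateN i c)   ≡⟨ rotateN-% (k ∸ i) (rotateN i c) (trans (length-rotateN i c) len) ⟨
    rotateN (k ∸ i) (rotateN i c)         ≡⟨ rotateN-+ i (k ∸ i) c ⟨
    rotateN (i + (k ∸ i)) c               ≡⟨ cong (λ j → rotateN j c) (trans (m+[n∸m]≡n (<⇒≤ i<k)) (sym len)) ⟩
    rotateN (length c) c                  ≡⟨ rotateN-length-id c ⟩
    c                                     ∎)
    where
    open ≡-Reasoning
    len : length c ≡ k
    len = proj₁ (proj₂ (proj₁ (∈-admissible⁻ c∈)))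

  k*representatives≡admissible : k * length representatives ≡ length admissible
  k*representatives≡admissible = begin
    k * length representatives                         ≡⟨ cong (_* length representatives) (length-upTo k) ⟨
    length (upTo k) * length representatives           ≡⟨ length-cartesianProduct (upTo k) representatives ⟨
    length rotations                                   ≡⟨ length-≡-by-bijection rotation
                                                            (Unique.cartesianProduct⁺ (Unique.upTo⁺ k) representatives-unique)
                                                            (compositions-unique k (suc k) m)
                                                            rotation-injective rotation-admissible rotation-onto ⟩
    length admissible                                  ∎
    where open ≡-Reasoning

  length-representatives : length representatives ≡ narayana k m
  length-representatives = begin
    length representatives                         ≡⟨ m*n/n≡m (length representatives) k ⟨
    length representatives * k / k                 ≡⟨ cong (_/ k) (trans (*-comm _ k) k*representatives≡admissible) ⟩
    length admissible / k                          ≡⟨ cong (_/ k) (length-compositions k (suc k) m) ⟩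
    compositionCount k (suc k) m / k               ≡⟨ narayana≡compositionCount/ n m ⟨
    narayana k m                                   ∎
    where open ≡-Reasoning

  representatives-inequivalent : AllPairs (λ a b → ¬ CyclicEquiv a b) representatives
  representatives-inequivalent = unique⇒allPairs-¬ equivalent⇒≡ representatives-unique
    where
    equivalent⇒≡ : ∀ {a b} → a ∈ representatives → b ∈ representatives → CyclicEquiv a b → a ≡ b
    equivalent⇒≡ {a} a∈ b∈ (i , eq) with ∈-representatives⁻ a∈ | ∈-representatives⁻ b∈
    ... | adm@((_ , len , _) , _) , doma | _ , domb =
      proj₂ (rotateN-injective (admissible-balanced adm) doma domb
               (subst (i % k <_) (sym len) (m%n<n i k)) (subst (0 <_) (sym len) z<s)
               (trans (sym (rotateN-% i a len)) eq))

  representatives-cover : ∀ c → Admissible c → Any (CyclicEquiv c) representatives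
  representatives-cover c adm with dominating-rotation-of adm
  ... | i , _ , r∈ = Any.map (i ,_) r∈

lemma4p1 : (k m : ℕ) → 1 ≤ k →
    NumClasses (λ c → IsComposition (2 * k + 1) k c × partsAtLeast2 c ≡ m)
               CyclicEquiv
               (narayana k m)
lemma4p1 zero    m ()
lemma4p1 (suc n) m _ =
  representatives , length-representatives , All.tabulate (λ c∈ → proj₁ (∈-representatives⁻ c∈)) ,
  representatives-inequivalent , representatives-cover
  where open Representatives n m
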